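{- Let $\mathcal{H}$ be a cancellative $3$-graph on $n$ vertices and let $G=\partial\mathcal{H}$. Let $U\subset V(\mathcal{H})$ be a set of size $m$, and let $G_U=G[U]$ and $\mathcal{H}_U=\mathcal{H}[U]$ be the induced subgraphs on $U$. Suppose that $|G_U|=xm^2/2$ for some real number $x$ with $0\le x\le(m-1)/m$. Then \[ |\mathcal{H}_U|\le\frac{(1-x)x}{6}m^3+3m^2. \]
   Context: A $3$-graph $\mathcal{H}$ is a finite vertex set with a set of $3$-element subsets (edges). The shadow $\partial\mathcal{H}=\{A\in\binom{V(\mathcal{H})}{2}: A\subset B\text{ for some }B\in\mathcal{H}\}$ is viewed as a graph on $V(\mathcal{H})$. $\mathcal{T}_3$ is the collection of all $3$-graphs on at most $5$ vertices with $3$ edges $A,B,C$ such that $A\triangle B\subset C$; a $3$-graph is cancellative iff it contains no member of $\mathcal{T}_3$ as a (not necessarily induced) subgraph.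
   Formalization: The real parameter x ranges over the rationals instead of the reals. -}

module Defs where

open import Data.Nat using (ℕ; zero; suc; _≤_)
open import Data.Nat.Properties using (_≟_)
open import Data.Bool using (Bool; true; false)
open import Data.List using (List; []; _∷_; _++_; map; filter; length)
open import Data.List.Membership.Propositional using (_∈_)
open import Data.List.Relation.Unary.Any using (any?)
open import Data.List.Relation.Unary.Unique.Propositional using (Unique)
open import Data.List.Relation.Unary.All using (All)
open import Data.Vec using (_∷_; [])
open import Data.Fin.Subset using (Subset; inside; outside; _⊆_; _∪_; _─_; ∣_∣)
open import Data.Fin.Subset.Properties using (_⊆?_)
open import Data.Product using (_×_)
open import Relation.Binary.PropositionalEquality using (_≡_; _≢_)
open import Relation.Nullary using (¬_)
open import Relation.Nullary.Decidable using (_×-dec_)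
open import Data.Integer using (+_)
open import Data.Rational using (ℚ; _/_)

allSubsets : (n : ℕ) → List (Subset n)
allSubsets zero = [] ∷ []
allSubsets (suc n) = map (outside ∷_) (allSubsets n) ++ map (inside ∷_) (allSubsets n)

record ThreeGraph (n : ℕ) : Set where
  field
    edges    : List (Subset n)
    unique   : Unique edges
    uniform  : All (λ e → ∣ e ∣ ≡ 3) edges
open ThreeGraph public

_△_ : ∀ {n} → Subset n → Subset n → Subset n
A △ B = (A ─ B) ∪ (B ─ A)

-- H contains no member of T₃: no three (distinct) edges A, B, C spanning at most
-- 5 vertices with A △ B ⊆ C.
Cancellative : ∀ {n} → ThreeGraph n → Set
Cancellative H = ∀ {A B C} → A ∈ edges H → B ∈ edges H → C ∈ edges H →
  A ≢ B → A ≢ C → B ≢ C → ∣ A ∪ (B ∪ C) ∣ ≤ 5 → ¬ ((A △ B) ⊆ C)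

shadowEdgesIn : ∀ {n} → ThreeGraph n → Subset n → ℕ
shadowEdgesIn {n} H U =
  length (filter (λ A → (∣ A ∣ ≟ 2) ×-dec ((A ⊆? U) ×-dec any? (λ B → A ⊆? B) (edges H)))
                 (allSubsets n))

edgesIn : ∀ {n} → ThreeGraph n → Subset n → ℕ
edgesIn H U = length (filter (λ B → B ⊆? U) (edges H))

ℕ→ℚ : ℕ → ℚ
ℕ→ℚ k = + k / 1

module Submission where

-- We prove the stronger inequality 3mh + 2g² ≤ g·m² in ℕ.
--
-- Write deg v for the degree of v in the shadow graph on U, α v = m - deg v, and
-- codeg a b for the number of edges in U through a and b.
--  * Cancellativity: if {a,b,c} and {a,b,y} are edges, then cy is not a shadow edge
--    (otherwise three edges would form a member of T₃).  So the third vertices of the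
--    edges through a and b are non-neighbours of c, whence codeg a b ≤ α c.
--  * Double counting: give each ordered pair (i, j) of an edge the weight α i / codeg i j.
--    Summed over the edges through ij these weights give α i, so the total is Σ deg·α;
--    by the codegree bound and AM–GM each edge carries at least 6, so 6h ≤ Σ deg·α.
--    To stay in ℕ all weights are scaled by the common denominator (m + h)!.
--  * Σ deg·α = m·Σ deg - Σ deg², Σ deg = 2g, and Cauchy–Schwarz (Σ deg)² ≤ m·Σ deg² give
--    6mh ≤ 2g·m² - 4g².  Substituting g = x·m²/2 in ℚ yields the theorem.

module Counting where

  open import Data.Nat using (ℕ; zero; suc; _+_; _*_; _∸_; _≤_; z≤n; s≤s; _≡ᵇ_; _!; >-nonZero)
  open import Data.Nat.Properties
  open import Data.Nat.Divisibility using (_∣_; ∣-trans; m∣m*n; m≤n⇒m!∣n!)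
  open import Data.Nat.DivMod using (_/_; m/n*n≡m)
  open import Data.Nat.Tactic.RingSolver using (solve-∀)
  open import Data.Bool using (Bool; true; false; if_then_else_; _∧_; _∨_; not)
  open import Data.Bool.Properties using (∨-zeroʳ)
  open import Data.Fin using (Fin; zero; suc)
  open import Data.List using (List; []; _∷_; map; _++_; length; filter)
  open import Data.List.Membership.Propositional using (_∈_; find; lose)
  open import Data.List.Membership.Propositional.Properties using (∈-map⁻; ∈-filter⁻)
  open import Data.List.Properties using (length-map)
  open import Data.Fin.Properties using () renaming (suc-injective to Fin-suc-injective)
  open import Data.List.Relation.Unary.Any using (Any; here; there; any?)
  open import Data.List.Relation.Unary.All using (All; []; _∷_)
  open import Data.List.Relation.Unary.AllPairs using ([]; _∷_)
  open import Data.List.Relation.Unary.Unique.Propositional using (Unique)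
  import Data.List.Relation.Unary.All as All
  import Data.List.Relation.Unary.Unique.Propositional.Properties as Unique
  open import Data.Vec using ([]; _∷_; lookup)
  open import Data.Vec.Properties using (lookup-zipWith; []=⇒lookup; lookup⇒[]=; lookup-replicate; tabulate∘lookup; tabulate-cong)
  open import Data.Fin.Subset using (Subset; ∣_∣; ⁅_⁆; _∪_; _─_; inside; outside; _⊆_) renaming (_∈_ to _∈ₛ_; ⊥ to ∅)
  open import Data.Fin.Subset.Properties using (∪-identityˡ; ∪-identityʳ; _⊆?_)
  open import Data.Product using (∃; _×_; _,_; proj₁; proj₂)
  open import Data.Sum using (_⊎_; inj₁; inj₂)
  open import Data.Empty using (⊥; ⊥-elim)
  open import Function using (_∘_)
  open import Relation.Binary.PropositionalEquality
  open import Relation.Nullary using (Dec; yes; does)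
  open import Relation.Nullary.Decidable using (_×-dec_; dec-true)
  open import Relation.Unary using (Pred; Decidable)
  open import Defs

  ⟦_⟧ : Bool → ℕ
  ⟦ true ⟧ = 1
  ⟦ false ⟧ = 0

  ⟦⟧≤1 : ∀ b → ⟦ b ⟧ ≤ 1
  ⟦⟧≤1 true = ≤-refl
  ⟦⟧≤1 false = z≤n

  ∑ : ∀ {n} → (Fin n → ℕ) → ℕ
  ∑ {zero} f = 0
  ∑ {suc n} f = f zero + ∑ (f ∘ suc)

  ∑ˡ : ∀ {A : Set} → (A → ℕ) → List A → ℕ
  ∑ˡ f [] = 0
  ∑ˡ f (x ∷ xs) = f x + ∑ˡ f xs

  count : ∀ {A : Set} → (A → Bool) → List A → ℕ
  count P = ∑ˡ (λ x → ⟦ P x ⟧)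

  interchange : ∀ a b c d → a + b + (c + d) ≡ a + c + (b + d)
  interchange = solve-∀

  ∑-cong : ∀ {n} {f g : Fin n → ℕ} → (∀ i → f i ≡ g i) → ∑ f ≡ ∑ g
  ∑-cong {zero} f≗g = refl
  ∑-cong {suc n} f≗g = cong₂ _+_ (f≗g zero) (∑-cong (f≗g ∘ suc))

  ∑-mono : ∀ {n} {f g : Fin n → ℕ} → (∀ i → f i ≤ g i) → ∑ f ≤ ∑ g
  ∑-mono {zero} f≤g = z≤n
  ∑-mono {suc n} f≤g = +-mono-≤ (f≤g zero) (∑-mono (f≤g ∘ suc))

  ∑-zero : ∀ {n} → ∑ {n} (λ _ → 0) ≡ 0
  ∑-zero {zero} = refl
  ∑-zero {suc n} = ∑-zero {n}

  ∑-+ : ∀ {n} (f g : Fin n → ℕ) → ∑ (λ i → f i + g i) ≡ ∑ f + ∑ g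
  ∑-+ {zero} f g = refl
  ∑-+ {suc n} f g = trans (cong (f zero + g zero +_) (∑-+ (f ∘ suc) (g ∘ suc)))
                          (interchange (f zero) (g zero) (∑ (f ∘ suc)) (∑ (g ∘ suc)))

  ∑-*ˡ : ∀ {n} c (f : Fin n → ℕ) → ∑ (λ i → c * f i) ≡ c * ∑ f
  ∑-*ˡ {zero} c f = sym (*-zeroʳ c)
  ∑-*ˡ {suc n} c f = trans (cong (c * f zero +_) (∑-*ˡ c (f ∘ suc))) (sym (*-distribˡ-+ c (f zero) _))

  ∑-*ʳ : ∀ {n} c (f : Fin n → ℕ) → ∑ (λ i → f i * c) ≡ ∑ f * c
  ∑-*ʳ c f = trans (∑-cong (λ i → *-comm (f i) c)) (trans (∑-*ˡ c f) (*-comm c _))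

  +-tight : ∀ {a b c d} → a ≤ b → c ≤ d → a + c ≡ b + d → a ≡ b × c ≡ d
  +-tight {a} {b} {c} {d} a≤b c≤d eq = a≡b , +-cancelˡ-≡ a c d (trans eq (cong (_+ d) (sym a≡b)))
    where
    a≡b : a ≡ b
    a≡b = ≤-antisym a≤b (+-cancelʳ-≤ c b a (≤-trans (+-monoʳ-≤ b c≤d) (≤-reflexive (sym eq))))

  ∑-tight : ∀ {n} (f g : Fin n → ℕ) → (∀ i → f i ≤ g i) → ∑ f ≡ ∑ g → ∀ i → f i ≡ g i
  ∑-tight f g f≤g eq zero = proj₁ (+-tight (f≤g zero) (∑-mono (f≤g ∘ suc)) eq)
  ∑-tight f g f≤g eq (suc i) =
    ∑-tight (f ∘ suc) (g ∘ suc) (f≤g ∘ suc) (proj₂ (+-tight (f≤g zero) (∑-mono (f≤g ∘ suc)) eq)) i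

  ∑ˡ-cong : ∀ {A : Set} {f g : A → ℕ} xs → (∀ x → f x ≡ g x) → ∑ˡ f xs ≡ ∑ˡ g xs
  ∑ˡ-cong [] f≗g = refl
  ∑ˡ-cong (x ∷ xs) f≗g = cong₂ _+_ (f≗g x) (∑ˡ-cong xs f≗g)

  ∑ˡ-mono : ∀ {A : Set} {f g : A → ℕ} xs → (∀ {x} → x ∈ xs → f x ≤ g x) → ∑ˡ f xs ≤ ∑ˡ g xs
  ∑ˡ-mono [] f≤g = z≤n
  ∑ˡ-mono (x ∷ xs) f≤g = +-mono-≤ (f≤g (here refl)) (∑ˡ-mono xs (f≤g ∘ there))

  ∑ˡ-++ : ∀ {A : Set} (f : A → ℕ) xs ys → ∑ˡ f (xs ++ ys) ≡ ∑ˡ f xs + ∑ˡ f ys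
  ∑ˡ-++ f [] ys = refl
  ∑ˡ-++ f (x ∷ xs) ys = trans (cong (f x +_) (∑ˡ-++ f xs ys)) (sym (+-assoc (f x) _ _))

  ∑ˡ-map : ∀ {A B : Set} (f : B → ℕ) (g : A → B) xs → ∑ˡ f (map g xs) ≡ ∑ˡ (f ∘ g) xs
  ∑ˡ-map f g [] = refl
  ∑ˡ-map f g (x ∷ xs) = cong (f (g x) +_) (∑ˡ-map f g xs)

  ∑ˡ-zero : ∀ {A : Set} (xs : List A) → ∑ˡ (λ _ → 0) xs ≡ 0
  ∑ˡ-zero [] = refl
  ∑ˡ-zero (x ∷ xs) = ∑ˡ-zero xs

  ∑ˡ-const : ∀ {A : Set} c (xs : List A) → ∑ˡ (λ _ → c) xs ≡ c * length xs
  ∑ˡ-const c [] = sym (*-zeroʳ c)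
  ∑ˡ-const c (x ∷ xs) = trans (cong (c +_) (∑ˡ-const c xs)) (sym (*-suc c (length xs)))

  ∑ˡ-*ʳ : ∀ {A : Set} (f : A → ℕ) c xs → ∑ˡ (λ x → f x * c) xs ≡ ∑ˡ f xs * c
  ∑ˡ-*ʳ f c [] = refl
  ∑ˡ-*ʳ f c (x ∷ xs) = trans (cong (f x * c +_) (∑ˡ-*ʳ f c xs)) (sym (*-distribʳ-+ c (f x) _))

  ∑ˡ-∑ : ∀ {A : Set} {n} (f : A → Fin n → ℕ) xs → ∑ˡ (λ x → ∑ (f x)) xs ≡ ∑ (λ i → ∑ˡ (λ x → f x i) xs)
  ∑ˡ-∑ {n = n} f [] = sym (∑-zero {n})
  ∑ˡ-∑ f (x ∷ xs) = trans (cong (∑ (f x) +_) (∑ˡ-∑ f xs)) (sym (∑-+ (f x) (λ i → ∑ˡ (λ x → f x i) xs)))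

  if-∑ : ∀ {n} (b : Bool) (g : Fin n → ℕ) → (if b then ∑ g else 0) ≡ ∑ (λ j → if b then g j else 0)
  if-∑ true g = refl
  if-∑ {n} false g = sym (∑-zero {n})

  ⟦⟧-square : ∀ x → ⟦ x ⟧ * ⟦ x ⟧ ≡ ⟦ x ⟧
  ⟦⟧-square true = refl
  ⟦⟧-square false = refl

  if-if : ∀ x y w → (if x then (if y then w else 0) else 0) ≡ ⟦ x ∧ y ⟧ * w
  if-if true true w = sym (+-identityʳ w)
  if-if true false w = refl
  if-if false y w = refl

  ∑ˡ-ordered-pairs : ∀ {A : Set} (w : A → A → ℕ) a b c → w a a ≡ 0 → w b b ≡ 0 → w c c ≡ 0 →
    ∑ˡ (λ i → ∑ˡ (w i) (a ∷ b ∷ c ∷ [])) (a ∷ b ∷ c ∷ []) ≡ (w b a + w c a) + (w a b + w c b) + (w a c + w b c)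
  ∑ˡ-ordered-pairs w a b c waa wbb wcc rewrite waa | wbb | wcc = regroup (w a b) (w a c) (w b a) (w b c) (w c a) (w c b)
    where
    regroup : ∀ ab ac ba bc ca cb →
      0 + (ab + (ac + 0)) + (ba + (0 + (bc + 0)) + (ca + (cb + (0 + 0)) + 0)) ≡ (ba + ca) + (ab + cb) + (ac + bc)
    regroup = solve-∀

  length-filter : ∀ {A : Set} {p} {P : Pred A p} (P? : Decidable P) xs →
    length (filter P? xs) ≡ count (λ x → does (P? x)) xs
  length-filter P? [] = refl
  length-filter P? (x ∷ xs) with does (P? x)
  ... | true = cong suc (length-filter P? xs)
  ... | false = length-filter P? xs

  count-≤-length : ∀ {A : Set} (P : A → Bool) xs → count P xs ≤ length xs
  count-≤-length P [] = z≤n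
  count-≤-length P (x ∷ xs) = +-mono-≤ (⟦⟧≤1 (P x)) (count-≤-length P xs)

  count-≥1 : ∀ {A : Set} (P : A → Bool) {x} xs → x ∈ xs → P x ≡ true → 1 ≤ count P xs
  count-≥1 P (y ∷ xs) (here refl) Px rewrite Px = s≤s z≤n
  count-≥1 P (y ∷ xs) (there x∈xs) Px = ≤-trans (count-≥1 P xs x∈xs Px) (m≤n+m _ _)

  count-zero-or-witness : ∀ {A : Set} (P : A → Bool) xs → count P xs ≡ 0 ⊎ ∃ λ x → x ∈ xs × P x ≡ true
  count-zero-or-witness P [] = inj₁ refl
  count-zero-or-witness P (x ∷ xs) with P x in Px
  ... | true = inj₂ (x , here refl , Px)
  ... | false with count-zero-or-witness P xs
  ... | inj₁ none = inj₁ none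
  ... | inj₂ (y , y∈xs , Py) = inj₂ (y , there y∈xs , Py)

  count-≤1 : ∀ {A : Set} (P : A → Bool) xs → Unique xs →
    (∀ {x y} → x ∈ xs → y ∈ xs → P x ≡ true → P y ≡ true → x ≡ y) → count P xs ≤ 1
  count-≤1 P [] _ _ = z≤n
  count-≤1 P (x ∷ xs) (x∉xs ∷ uniq) atMostOne with P x in Px
  ... | false = count-≤1 P xs uniq (λ x∈ y∈ → atMostOne (there x∈) (there y∈))
  ... | true = ≤-reflexive (cong suc (none xs (λ y∈ → All.lookup x∉xs y∈) (λ y∈ Py → atMostOne (here refl) (there y∈) Px Py)))
    where
    none : ∀ ys → (∀ {y} → y ∈ ys → x ≢ y) → (∀ {y} → y ∈ ys → P y ≡ true → x ≡ y) → count P ys ≡ 0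
    none [] _ _ = refl
    none (y ∷ ys) x≢ same with P y in Py
    ... | true = ⊥-elim (x≢ (here refl) (same (here refl) Py))
    ... | false = none ys (x≢ ∘ there) (same ∘ there)

  -- A boolean equality test on Fin n, so that membership in {a, b, c} can be computed
  -- pointwise; it is reflexive, symmetric and reflects equality.
  infix 8 _==_
  _==_ : ∀ {n} → Fin n → Fin n → Bool
  zero == zero = true
  zero == suc j = false
  suc i == zero = false
  suc i == suc j = i == j

  ==-refl : ∀ {n} (i : Fin n) → (i == i) ≡ true
  ==-refl zero = refl
  ==-refl (suc i) = ==-refl i

  ==-sound : ∀ {n} {i j : Fin n} → (i == j) ≡ true → i ≡ j
  ==-sound {i = zero} {zero} _ = refl
  ==-sound {i = suc i} {suc j} eq = cong suc (==-sound eq)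

  ==-sym : ∀ {n} (i j : Fin n) → (i == j) ≡ (j == i)
  ==-sym zero zero = refl
  ==-sym zero (suc j) = refl
  ==-sym (suc i) zero = refl
  ==-sym (suc i) (suc j) = ==-sym i j

  ==-complete : ∀ {n} {i j : Fin n} → i ≢ j → (i == j) ≡ false
  ==-complete {i = i} {j} i≢j with i == j in eq
  ... | false = refl
  ... | true = ⊥-elim (i≢j (==-sound eq))

  ==-both : ∀ {n} (i x y : Fin n) → (i == x) ≡ true → (i == y) ≡ true → (x == y) ≡ true
  ==-both i x y i=x i=y with ==-sound {i = i} {x} i=x | ==-sound {i = i} {y} i=y
  ... | refl | refl = ==-refl i

  ∑-point : ∀ {n} (a : Fin n) → ∑ (λ i → ⟦ i == a ⟧) ≡ 1
  ∑-point {suc n} zero = cong suc (∑-zero {n})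
  ∑-point {suc n} (suc a) = ∑-point a

  false≢true : false ≢ true
  false≢true ()

  ⟦⟧-injective : ∀ {x y} → ⟦ x ⟧ ≡ ⟦ y ⟧ → x ≡ y
  ⟦⟧-injective {true} {true} _ = refl
  ⟦⟧-injective {false} {false} _ = refl

  ⟦⟧-mono : ∀ {x y} → (x ≡ true → y ≡ true) → ⟦ x ⟧ ≤ ⟦ y ⟧
  ⟦⟧-mono {false} _ = z≤n
  ⟦⟧-mono {true} x⇒y rewrite x⇒y refl = ≤-refl

  lookup-== : ∀ {n} (e : Subset n) {x} k → (x == k) ≡ true → lookup e k ≡ true → lookup e x ≡ true
  lookup-== e {x} k x=k k∈e = subst (λ l → lookup e l ≡ true) (sym (==-sound {i = x} {k} x=k)) k∈e

  lookup-∪ : ∀ {n} (p q : Subset n) i → lookup (p ∪ q) i ≡ (lookup p i ∨ lookup q i)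
  lookup-∪ p q i = lookup-zipWith _∨_ i p q

  lookup-─ : ∀ {n} (p q : Subset n) i → lookup (p ─ q) i ≡ (lookup p i ∧ not (lookup q i))
  lookup-─ (true ∷ p) (true ∷ q) zero = refl
  lookup-─ (true ∷ p) (false ∷ q) zero = refl
  lookup-─ (false ∷ p) (true ∷ q) zero = refl
  lookup-─ (false ∷ p) (false ∷ q) zero = refl
  lookup-─ (x ∷ p) (y ∷ q) (suc i) = lookup-─ p q i

  lookup-⁅⁆ : ∀ {n} (j i : Fin n) → lookup ⁅ j ⁆ i ≡ (i == j)
  lookup-⁅⁆ zero zero = refl
  lookup-⁅⁆ zero (suc i) = lookup-replicate i false
  lookup-⁅⁆ (suc j) zero = refl
  lookup-⁅⁆ (suc j) (suc i) = lookup-⁅⁆ j i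

  pair : ∀ {n} → Fin n → Fin n → Subset n
  pair i j = ⁅ i ⁆ ∪ ⁅ j ⁆

  lookup-pair : ∀ {n} (i j x : Fin n) → lookup (pair i j) x ≡ (x == i ∨ x == j)
  lookup-pair i j x = trans (lookup-∪ ⁅ i ⁆ ⁅ j ⁆ x) (cong₂ _∨_ (lookup-⁅⁆ i x) (lookup-⁅⁆ j x))

  subset-ext : ∀ {n} {p q : Subset n} → (∀ i → lookup p i ≡ lookup q i) → p ≡ q
  subset-ext {p = p} {q} p≗q = trans (sym (tabulate∘lookup p)) (trans (tabulate-cong p≗q) (tabulate∘lookup q))

  card-∑ : ∀ {n} (p : Subset n) → ∣ p ∣ ≡ ∑ (λ i → ⟦ lookup p i ⟧)
  card-∑ [] = refl
  card-∑ (true ∷ p) = cong suc (card-∑ p)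
  card-∑ (false ∷ p) = card-∑ p

  ⟦three⟧ : ∀ {n} (a b c : Fin n) → (a == b) ≡ false → (a == c) ≡ false → (b == c) ≡ false →
    ∀ i → ⟦ i == a ∨ i == b ∨ i == c ⟧ ≡ ⟦ i == a ⟧ + ⟦ i == b ⟧ + ⟦ i == c ⟧
  ⟦three⟧ a b c a≠b a≠c b≠c i with i == a in ia | i == b in ib | i == c in ic
  ... | true | true | _ = ⊥-elim (false≢true (trans (sym a≠b) (==-both i a b ia ib)))
  ... | true | false | true = ⊥-elim (false≢true (trans (sym a≠c) (==-both i a c ia ic)))
  ... | false | true | true = ⊥-elim (false≢true (trans (sym b≠c) (==-both i b c ib ic)))
  ... | true | false | false = refl
  ... | false | true | false = refl
  ... | false | false | true = refl
  ... | false | false | false = refl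

  -- A 3-element set containing three distinct points a, b, c is exactly {a, b, c}:
  -- the indicator of {a, b, c} is below that of e and both sum to 3.
  three-set : ∀ {n} (e : Subset n) (a b c : Fin n) → ∣ e ∣ ≡ 3 →
    (a == b) ≡ false → (a == c) ≡ false → (b == c) ≡ false →
    lookup e a ≡ true → lookup e b ≡ true → lookup e c ≡ true →
    ∀ i → lookup e i ≡ (i == a ∨ i == b ∨ i == c)
  three-set e a b c |e|≡3 a≠b a≠c b≠c ea eb ec i =
    sym (⟦⟧-injective (∑-tight abc (λ i → ⟦ lookup e i ⟧) abc≤e ∑abc≡∑e i))
    where
    abc : Fin _ → ℕ
    abc i = ⟦ i == a ∨ i == b ∨ i == c ⟧
    abc≤e : ∀ i → abc i ≤ ⟦ lookup e i ⟧
    abc≤e i = ⟦⟧-mono λ i∈abc → in-e (i == a) (i == b) (i == c) refl refl refl i∈abc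
      where
      in-e : ∀ x y z → (i == a) ≡ x → (i == b) ≡ y → (i == c) ≡ z → (x ∨ y ∨ z) ≡ true → lookup e i ≡ true
      in-e true y z ia _ _ _ = lookup-== e a ia ea
      in-e false true z _ ib _ _ = lookup-== e b ib eb
      in-e false false true _ _ ic _ = lookup-== e c ic ec
    ∑abc≡∑e : ∑ abc ≡ ∑ (λ i → ⟦ lookup e i ⟧)
    ∑abc≡∑e = begin
      ∑ abc                                                 ≡⟨ ∑-cong (⟦three⟧ a b c a≠b a≠c b≠c) ⟩
      ∑ (λ i → ⟦ i == a ⟧ + ⟦ i == b ⟧ + ⟦ i == c ⟧)         ≡⟨ ∑-+ _ (λ i → ⟦ i == c ⟧) ⟩
      ∑ (λ i → ⟦ i == a ⟧ + ⟦ i == b ⟧) + ∑ (λ i → ⟦ i == c ⟧) ≡⟨ cong (_+ _) (∑-+ (λ i → ⟦ i == a ⟧) _) ⟩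
      ∑ (λ i → ⟦ i == a ⟧) + ∑ (λ i → ⟦ i == b ⟧) + ∑ (λ i → ⟦ i == c ⟧)
                                                            ≡⟨ cong₂ _+_ (cong₂ _+_ (∑-point a) (∑-point b)) (∑-point c) ⟩
      3                                                     ≡⟨ trans (sym |e|≡3) (card-∑ e) ⟩
      ∑ (λ i → ⟦ lookup e i ⟧)                              ∎
      where open ≡-Reasoning

  ∈⇒lookup : ∀ {n} {p : Subset n} {i} → i ∈ₛ p → lookup p i ≡ true
  ∈⇒lookup = []=⇒lookup

  lookup⇒∈ : ∀ {n} {p : Subset n} {i} → lookup p i ≡ true → i ∈ₛ p
  lookup⇒∈ {p = p} {i} = lookup⇒[]= i p

  ∧-true : ∀ {x y} → (x ∧ y) ≡ true → x ≡ true × y ≡ true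
  ∧-true {true} {true} _ = refl , refl

  not-true : ∀ {x} → not x ≡ true → x ≡ false
  not-true {false} _ = refl

  does-true : ∀ {P : Set} (P? : Dec P) → does P? ≡ true → P
  does-true (yes p) _ = p

  pair-∋ˡ : ∀ {n} (i j : Fin n) → i ∈ₛ pair i j
  pair-∋ˡ i j = lookup⇒∈ (trans (lookup-pair i j i) (cong (_∨ (i == j)) (==-refl i)))

  pair-∋ʳ : ∀ {n} (i j : Fin n) → j ∈ₛ pair i j
  pair-∋ʳ i j = lookup⇒∈ (trans (lookup-pair i j j) (trans (cong ((j == i) ∨_) (==-refl j)) (∨-zeroʳ (j == i))))

  pair-⊆ : ∀ {n} {e : Subset n} (i j : Fin n) → lookup e i ≡ true → lookup e j ≡ true → pair i j ⊆ e
  pair-⊆ {e = e} i j i∈e j∈e {x} x∈pair with x == i in x=i | x == j in x=j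
  ... | true | _ = lookup⇒∈ (lookup-== e i x=i i∈e)
  ... | false | true = lookup⇒∈ (lookup-== e j x=j j∈e)
  ... | false | false = ⊥-elim (false≢true (trans (sym (trans (lookup-pair i j x) (cong₂ _∨_ x=i x=j))) (∈⇒lookup x∈pair)))

  difference-⊆ : ∀ {n} {A B C : Subset n} {a b c y : Fin n} →
    (∀ i → lookup A i ≡ (i == a ∨ i == b ∨ i == c)) → (∀ i → lookup B i ≡ (i == a ∨ i == b ∨ i == y)) →
    lookup C c ≡ true → lookup C y ≡ true → (A △ B) ⊆ C
  difference-⊆ {A = A} {B} {C} {a} {b} {c} {y} A≡abc B≡aby c∈C y∈C {x} x∈A△B with x == c in x=c | x == y in x=y
  ... | true | _ = lookup⇒∈ (lookup-== C c x=c c∈C)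
  ... | false | true = lookup⇒∈ (lookup-== C y x=y y∈C)
  ... | false | false = ⊥-elim (false≢true (trans (sym (trans A△B-at-x (self-difference u))) (∈⇒lookup x∈A△B)))
    where
    u : Bool
    u = x == a ∨ x == b ∨ false
    Ax : lookup A x ≡ u
    Ax = trans (A≡abc x) (cong (λ z → x == a ∨ x == b ∨ z) x=c)
    Bx : lookup B x ≡ u
    Bx = trans (B≡aby x) (cong (λ z → x == a ∨ x == b ∨ z) x=y)
    A△B-at-x : lookup (A △ B) x ≡ ((u ∧ not u) ∨ (u ∧ not u))
    A△B-at-x = trans (lookup-∪ (A ─ B) (B ─ A) x)
      (cong₂ _∨_ (trans (lookup-─ A B x) (cong₂ (λ v w → v ∧ not w) Ax Bx))
                 (trans (lookup-─ B A x) (cong₂ (λ v w → v ∧ not w) Bx Ax)))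
    self-difference : ∀ v → ((v ∧ not v) ∨ (v ∧ not v)) ≡ false
    self-difference true = refl
    self-difference false = refl

  union-bound : ∀ {n} {A B C : Subset n} {a b c y : Fin n} →
    (∀ i → lookup A i ≡ (i == a ∨ i == b ∨ i == c)) → (∀ i → lookup B i ≡ (i == a ∨ i == b ∨ i == y)) →
    lookup C c ≡ true → lookup C y ≡ true → ∣ A ∪ (B ∪ C) ∣ ≤ 2 + ∣ C ∣
  union-bound {A = A} {B} {C} {a} {b} {c} {y} A≡abc B≡aby c∈C y∈C = begin
    ∣ A ∪ (B ∪ C) ∣                                            ≡⟨ card-∑ (A ∪ (B ∪ C)) ⟩
    ∑ (λ i → ⟦ lookup (A ∪ (B ∪ C)) i ⟧)                       ≤⟨ ∑-mono pointwise ⟩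
    ∑ (λ i → ⟦ i == a ⟧ + ⟦ i == b ⟧ + ⟦ lookup C i ⟧)          ≡⟨ ∑-+ _ (λ i → ⟦ lookup C i ⟧) ⟩
    ∑ (λ i → ⟦ i == a ⟧ + ⟦ i == b ⟧) + ∑ (λ i → ⟦ lookup C i ⟧)
      ≡⟨ cong₂ _+_ (trans (∑-+ (λ i → ⟦ i == a ⟧) _) (cong₂ _+_ (∑-point a) (∑-point b))) (sym (card-∑ C)) ⟩
    2 + ∣ C ∣                                                  ∎
    where
    open ≤-Reasoning
    pointwise : ∀ i → ⟦ lookup (A ∪ (B ∪ C)) i ⟧ ≤ ⟦ i == a ⟧ + ⟦ i == b ⟧ + ⟦ lookup C i ⟧
    pointwise i rewrite lookup-∪ A (B ∪ C) i | lookup-∪ B C i | A≡abc i | B≡aby i with i == a | i == b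
    ... | true | _ = s≤s z≤n
    ... | false | true = s≤s z≤n
    ... | false | false with i == c in i=c | i == y in i=y | lookup C i in i∈C
    ...   | _ | _ | true = ⟦⟧≤1 _
    ...   | false | false | false = z≤n
    ...   | true | _ | false = ⊥-elim (false≢true (trans (sym i∈C) (lookup-== C c i=c c∈C)))
    ...   | false | true | false = ⊥-elim (false≢true (trans (sym i∈C) (lookup-== C y i=y y∈C)))

  record Spans {n} (e : Subset n) (x y z : Fin n) : Set where
    field
      x≠y : (x == y) ≡ false
      x≠z : (x == z) ≡ false
      y≠z : (y == z) ≡ false
      x∈e : lookup e x ≡ true
      y∈e : lookup e y ≡ true
      z∈e : lookup e z ≡ true

  swap₁₂ : ∀ {n} {e : Subset n} {x y z} → Spans e x y z → Spans e y x z
  swap₁₂ {x = x} {y} s = record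
    { x≠y = trans (==-sym y x) x≠y ; x≠z = y≠z ; y≠z = x≠z ; x∈e = y∈e ; y∈e = x∈e ; z∈e = z∈e }
    where open Spans s

  swap₂₃ : ∀ {n} {e : Subset n} {x y z} → Spans e x y z → Spans e x z y
  swap₂₃ {y = y} {z} s = record
    { x≠y = x≠z ; x≠z = x≠y ; y≠z = trans (==-sym z y) y≠z ; x∈e = x∈e ; y∈e = z∈e ; z∈e = y∈e }
    where open Spans s

  spans-set : ∀ {n} {e : Subset n} {x y z} → ∣ e ∣ ≡ 3 → Spans e x y z → ∀ i → lookup e i ≡ (i == x ∨ i == y ∨ i == z)
  spans-set {e = e} {x} {y} {z} |e|≡3 s = three-set e x y z |e|≡3 x≠y x≠z y≠z x∈e y∈e z∈e
    where open Spans s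

  elements : ∀ {n} → Subset n → List (Fin n)
  elements [] = []
  elements (false ∷ p) = map suc (elements p)
  elements (true ∷ p) = zero ∷ map suc (elements p)

  elements-∈ : ∀ {n} (p : Subset n) {i} → i ∈ elements p → lookup p i ≡ true
  elements-∈ (false ∷ p) i∈ with ∈-map⁻ suc i∈
  ... | j , j∈ , refl = elements-∈ p j∈
  elements-∈ (true ∷ p) (here refl) = refl
  elements-∈ (true ∷ p) (there i∈) with ∈-map⁻ suc i∈
  ... | j , j∈ , refl = elements-∈ p j∈

  elements-length : ∀ {n} (p : Subset n) → length (elements p) ≡ ∣ p ∣
  elements-length [] = refl
  elements-length (false ∷ p) = trans (length-map suc (elements p)) (elements-length p)
  elements-length (true ∷ p) = cong suc (trans (length-map suc (elements p)) (elements-length p))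

  elements-unique : ∀ {n} (p : Subset n) → Unique (elements p)
  elements-unique [] = []
  elements-unique (false ∷ p) = Unique.map⁺ Fin-suc-injective (elements-unique p)
  elements-unique (true ∷ p) = All.tabulate zero∉ ∷ Unique.map⁺ Fin-suc-injective (elements-unique p)
    where
    zero∉ : ∀ {j} → j ∈ map suc (elements p) → zero ≢ j
    zero∉ j∈ refl with ∈-map⁻ suc j∈
    ... | _ , _ , ()

  ∑-elements : ∀ {n} (p : Subset n) (φ : Fin n → ℕ) →
    ∑ (λ i → if lookup p i then φ i else 0) ≡ ∑ˡ φ (elements p)
  ∑-elements [] φ = refl
  ∑-elements (false ∷ p) φ = trans (∑-elements p (φ ∘ suc)) (sym (∑ˡ-map φ suc (elements p)))
  ∑-elements (true ∷ p) φ = cong (φ zero +_) (trans (∑-elements p (φ ∘ suc)) (sym (∑ˡ-map φ suc (elements p))))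

  three-elements : ∀ {n} (e : Subset n) → ∣ e ∣ ≡ 3 →
    ∃ λ a → ∃ λ b → ∃ λ c → elements e ≡ a ∷ b ∷ c ∷ [] × a ≢ b × a ≢ c × b ≢ c
  three-elements e |e|≡3 with elements e | elements-length e | elements-unique e
  ... | a ∷ b ∷ c ∷ [] | _ | (a≢b ∷ a≢c ∷ []) ∷ (b≢c ∷ []) ∷ _ = a , b , c , refl , a≢b , a≢c , b≢c
  ... | [] | len | _ with () ← trans len |e|≡3
  ... | _ ∷ [] | len | _ with () ← trans len |e|≡3
  ... | _ ∷ _ ∷ [] | len | _ with () ← trans len |e|≡3
  ... | _ ∷ _ ∷ _ ∷ _ ∷ _ | len | _ with () ← trans len |e|≡3

  ∑ˡ-allSubsets : ∀ {n} (f : Subset (suc n) → ℕ) → ∑ˡ f (allSubsets (suc n)) ≡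
    ∑ˡ (λ A → f (outside ∷ A)) (allSubsets n) + ∑ˡ (λ A → f (inside ∷ A)) (allSubsets n)
  ∑ˡ-allSubsets {n} f = trans (∑ˡ-++ f (map (outside ∷_) (allSubsets n)) _)
    (cong₂ _+_ (∑ˡ-map f (outside ∷_) (allSubsets n)) (∑ˡ-map f (inside ∷_) (allSubsets n)))

  -- Counting subsets of size 0, 1 and 2 with a property q: there is one empty set, the
  -- singletons are indexed by points, and each 2-set {i, j} arises from two ordered pairs.
  count-size-0 : ∀ n (q : Subset n → Bool) → count (λ A → (∣ A ∣ ≡ᵇ 0) ∧ q A) (allSubsets n) ≡ ⟦ q ∅ ⟧
  count-size-0 zero q = +-identityʳ _
  count-size-0 (suc n) q = trans (∑ˡ-allSubsets (λ A → ⟦ (∣ A ∣ ≡ᵇ 0) ∧ q A ⟧))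
    (trans (cong₂ _+_ (count-size-0 n (λ A → q (outside ∷ A))) (∑ˡ-zero (allSubsets n))) (+-identityʳ _))

  count-size-1 : ∀ n (q : Subset n → Bool) → count (λ A → (∣ A ∣ ≡ᵇ 1) ∧ q A) (allSubsets n) ≡ ∑ (λ j → ⟦ q ⁅ j ⁆ ⟧)
  count-size-1 zero q = refl
  count-size-1 (suc n) q = trans (∑ˡ-allSubsets (λ A → ⟦ (∣ A ∣ ≡ᵇ 1) ∧ q A ⟧))
    (trans (cong₂ _+_ (count-size-1 n (λ A → q (outside ∷ A))) (count-size-0 n (λ A → q (inside ∷ A))))
           (+-comm (∑ (λ j → ⟦ q (outside ∷ ⁅ j ⁆) ⟧)) ⟦ q (inside ∷ ∅) ⟧))

  count-size-2 : ∀ n (q : Subset n → Bool) →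
    2 * count (λ A → (∣ A ∣ ≡ᵇ 2) ∧ q A) (allSubsets n) ≡ ∑ (λ i → ∑ (λ j → ⟦ not (i == j) ∧ q (pair i j) ⟧))
  count-size-2 zero q = refl
  count-size-2 (suc n) q = begin
    2 * count (λ A → (∣ A ∣ ≡ᵇ 2) ∧ q A) (allSubsets (suc n))
      ≡⟨ cong (2 *_) (∑ˡ-allSubsets (λ A → ⟦ (∣ A ∣ ≡ᵇ 2) ∧ q A ⟧)) ⟩
    2 * (without0 + with0)                ≡⟨ *-distribˡ-+ 2 without0 with0 ⟩
    2 * without0 + 2 * with0              ≡⟨ cong₂ _+_ (count-size-2 n (λ A → q (outside ∷ A)))
                                                       (cong (2 *_) (count-size-1 n (λ A → q (inside ∷ A)))) ⟩
    pairsAbove0 + 2 * pairs0              ≡⟨ rearrange pairsAbove0 pairs0 ⟩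
    pairs0 + (pairs0 + pairsAbove0)       ≡⟨ cong₂ _+_ (∑-cong (λ j → cong (λ z → ⟦ q (inside ∷ z) ⟧) (sym (∪-identityˡ ⁅ j ⁆))))
                                               (trans (cong (_+ pairsAbove0) (∑-cong (λ i → cong (λ z → ⟦ q (inside ∷ z) ⟧) (sym (∪-identityʳ ⁅ i ⁆)))))
                                                      (sym (∑-+ (λ i → ⟦ q (inside ∷ (⁅ i ⁆ ∪ ∅)) ⟧)
                                                                (λ i → ∑ (λ j → ⟦ not (i == j) ∧ q (outside ∷ pair i j) ⟧))))) ⟩
    ∑ (λ i → ∑ (λ j → ⟦ not (i == j) ∧ q (pair i j) ⟧)) ∎
    where
    open ≡-Reasoning
    without0 with0 pairsAbove0 pairs0 : ℕ
    without0 = count (λ A → (∣ A ∣ ≡ᵇ 2) ∧ q (outside ∷ A)) (allSubsets n)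
    with0 = count (λ A → (∣ A ∣ ≡ᵇ 1) ∧ q (inside ∷ A)) (allSubsets n)
    pairsAbove0 = ∑ (λ i → ∑ (λ j → ⟦ not (i == j) ∧ q (outside ∷ pair i j) ⟧))
    pairs0 = ∑ (λ j → ⟦ q (inside ∷ ⁅ j ⁆) ⟧)
    rearrange : ∀ r s → r + 2 * s ≡ s + (s + r)
    rearrange = solve-∀

  square-reflects-≤ : ∀ u v → u * u ≤ v * v → u ≤ v
  square-reflects-≤ u v u²≤v² with ≤-<-connex u v
  ... | inj₁ u≤v = u≤v
  ... | inj₂ v<u = ⊥-elim (<⇒≱ (*-mono-< v<u v<u) u²≤v²)

  -- AM–GM in the form 4PQ ≤ (P + Q)²: if Q = P + d the difference is d².
  am-gm-ordered : ∀ P Q → P ≤ Q → 4 * (P * Q) ≤ (P + Q) * (P + Q)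
  am-gm-ordered P Q P≤Q = subst (λ Q → 4 * (P * Q) ≤ (P + Q) * (P + Q)) (m+[n∸m]≡n P≤Q)
    (≤-trans (m≤m+n _ (d * d)) (≤-reflexive (expand P d)))
    where
    d : ℕ
    d = Q ∸ P
    expand : ∀ a d → 4 * (a * (a + d)) + d * d ≡ (a + (a + d)) * (a + (a + d))
    expand = solve-∀

  am-gm : ∀ P Q → 4 * (P * Q) ≤ (P + Q) * (P + Q)
  am-gm P Q with ≤-total P Q
  ... | inj₁ P≤Q = am-gm-ordered P Q P≤Q
  ... | inj₂ Q≤P = subst₂ _≤_ (cong (4 *_) (*-comm Q P)) (cong (λ s → s * s) (+-comm Q P)) (am-gm-ordered Q P Q≤P)

  cross-term : ∀ x y A B C → C * C ≤ A * B → 2 * x * y * C ≤ x * x * B + y * y * A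
  cross-term x y A B C C²≤AB = square-reflects-≤ (2 * x * y * C) (x * x * B + y * y * A) (begin
    2 * x * y * C * (2 * x * y * C)       ≡⟨ regroup₁ x y C ⟩
    4 * (x * x * (y * y)) * (C * C)       ≤⟨ *-monoʳ-≤ (4 * (x * x * (y * y))) C²≤AB ⟩
    4 * (x * x * (y * y)) * (A * B)       ≡⟨ regroup₂ x y A B ⟩
    4 * ((x * x * B) * (y * y * A))       ≤⟨ am-gm (x * x * B) (y * y * A) ⟩
    (x * x * B + y * y * A) * (x * x * B + y * y * A) ∎)
    where
    open ≤-Reasoning
    regroup₁ : ∀ x y C → 2 * x * y * C * (2 * x * y * C) ≡ 4 * (x * x * (y * y)) * (C * C)
    regroup₁ = solve-∀
    regroup₂ : ∀ x y A B → 4 * (x * x * (y * y)) * (A * B) ≡ 4 * ((x * x * B) * (y * y * A))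
    regroup₂ = solve-∀

  cauchy-schwarz : ∀ {n} (a b : Fin n → ℕ) →
    ∑ (λ i → a i * b i) * ∑ (λ i → a i * b i) ≤ ∑ (λ i → a i * a i) * ∑ (λ i → b i * b i)
  cauchy-schwarz {zero} a b = z≤n
  cauchy-schwarz {suc n} a b = begin
    (x * y + C) * (x * y + C)                           ≡⟨ expand x y C ⟩
    x * x * (y * y) + 2 * x * y * C + C * C             ≤⟨ +-mono-≤ (+-monoʳ-≤ (x * x * (y * y)) (cross-term x y A B C ih)) ih ⟩
    x * x * (y * y) + (x * x * B + y * y * A) + A * B   ≡⟨ factor x y A B ⟩
    (x * x + A) * (y * y + B)                           ∎
    where
    open ≤-Reasoning
    x y A B C : ℕ
    x = a zero
    y = b zero
    A = ∑ (λ i → a (suc i) * a (suc i))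
    B = ∑ (λ i → b (suc i) * b (suc i))
    C = ∑ (λ i → a (suc i) * b (suc i))
    ih : C * C ≤ A * B
    ih = cauchy-schwarz (a ∘ suc) (b ∘ suc)
    expand : ∀ x y C → (x * y + C) * (x * y + C) ≡ x * x * (y * y) + 2 * x * y * C + C * C
    expand = solve-∀
    factor : ∀ x y A B → x * x * (y * y) + (x * x * B + y * y * A) + A * B ≡ (x * x + A) * (y * y + B)
    factor = solve-∀

  ∣-factorial : ∀ {k N} → 1 ≤ k → k ≤ N → k ∣ N !
  ∣-factorial {suc k} _ k≤N = ∣-trans (m∣m*n (k !)) (m≤n⇒m!∣n! k≤N)

  -- Reciprocals 1/f of the numbers 1 ≤ f ≤ N, scaled by the common denominator K = N!,
  -- so that fractional weights can be handled in ℕ.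
  module ScaledReciprocals (N : ℕ) where

    K : ℕ
    K = N !

    recip : ℕ → ℕ
    recip zero = 0
    recip (suc f) = K / suc f

    recip-* : ∀ f → 1 ≤ f → f ≤ N → recip f * f ≡ K
    recip-* (suc f) _ f≤N = m/n*n≡m (∣-factorial (s≤s z≤n) f≤N)

    recip-antitone : ∀ f g → 1 ≤ f → f ≤ g → g ≤ N → recip g ≤ recip f
    recip-antitone f g 1≤f f≤g g≤N with ≤-<-connex (recip g) (recip f)
    ... | inj₁ ok = ok
    ... | inj₂ recipf<recipg = ⊥-elim (<-irrefl refl (begin-strict
          K            ≡⟨ sym (recip-* f 1≤f (≤-trans f≤g g≤N)) ⟩
          recip f * f  <⟨ *-monoˡ-< f {{>-nonZero 1≤f}} recipf<recipg ⟩
          recip g * f  ≤⟨ *-monoʳ-≤ (recip g) f≤g ⟩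
          recip g * g  ≡⟨ recip-* g (≤-trans 1≤f f≤g) g≤N ⟩
          K            ∎))
      where open ≤-Reasoning

    -- x/z + z/x ≥ 2, scaled by K: the two terms have product K².
    recip-am-gm : ∀ x z → 1 ≤ x → 1 ≤ z → x ≤ N → z ≤ N → 2 * K ≤ recip z * x + recip x * z
    recip-am-gm x z 1≤x 1≤z x≤N z≤N = square-reflects-≤ (2 * K) (P + Q) (begin
        2 * K * (2 * K) ≡⟨ four-squares K ⟩
        4 * (K * K)     ≡⟨ cong (4 *_) (sym PQ≡K²) ⟩
        4 * (P * Q)     ≤⟨ am-gm P Q ⟩
        (P + Q) * (P + Q) ∎)
      where
      open ≤-Reasoning
      P Q : ℕ
      P = recip z * x
      Q = recip x * z
      four-squares : ∀ K → 2 * K * (2 * K) ≡ 4 * (K * K)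
      four-squares = solve-∀
      swap : ∀ a b c d → a * b * (c * d) ≡ (a * d) * (c * b)
      swap = solve-∀
      PQ≡K² : P * Q ≡ K * K
      PQ≡K² = trans (swap (recip z) x (recip x) z) (cong₂ _*_ (recip-* z 1≤z z≤N) (recip-* x 1≤x x≤N))

  module ShadowCounting {n : ℕ} (H : ThreeGraph n) (canc : Cancellative H) (U : Subset n) where

    m : ℕ
    m = ∣ U ∣

    E : List (Subset n)
    E = filter (λ B → B ⊆? U) (edges H)

    h : ℕ
    h = length E

    g : ℕ
    g = shadowEdgesIn H U

    E-edge : ∀ {e} → e ∈ E → e ∈ edges H × e ⊆ U
    E-edge = ∈-filter⁻ (λ B → B ⊆? U)

    E-card : ∀ {e} → e ∈ E → ∣ e ∣ ≡ 3
    E-card e∈E = All.lookup (uniform H) (proj₁ (E-edge e∈E))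

    E-unique : Unique E
    E-unique = Unique.filter⁺ (λ B → B ⊆? U) (unique H)

    E-⊆U : ∀ {e} → e ∈ E → ∀ {i} → lookup e i ≡ true → lookup U i ≡ true
    E-⊆U e∈E i∈e = ∈⇒lookup (proj₂ (E-edge e∈E) (lookup⇒∈ i∈e))

    inShadow? : (A : Subset n) → Dec (A ⊆ U × Any (A ⊆_) (edges H))
    inShadow? A = (A ⊆? U) ×-dec any? (λ B → A ⊆? B) (edges H)

    -- Adjacency in the shadow graph on U, the degree, the number α of non-neighbours in U
    -- (the vertex itself included), and the codegree of a pair.
    adjacent : Fin n → Fin n → Bool
    adjacent i j = not (i == j) ∧ does (inShadow? (pair i j))

    deg : Fin n → ℕ
    deg i = ∑ (λ j → ⟦ adjacent i j ⟧)

    α : Fin n → ℕ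
    α i = m ∸ deg i

    codeg : Fin n → Fin n → ℕ
    codeg i j = count (λ e → lookup e i ∧ lookup e j) E

    handshake : 2 * g ≡ ∑ deg
    handshake = trans (cong (2 *_) (length-filter _ (allSubsets n))) (count-size-2 n (λ A → does (inShadow? A)))

    adjacent-inShadow : ∀ i j → adjacent i j ≡ true → pair i j ⊆ U × Any (pair i j ⊆_) (edges H)
    adjacent-inShadow i j adj = does-true (inShadow? (pair i j)) (proj₂ (∧-true {not (i == j)} adj))

    adjacent-in-U : ∀ i j → adjacent i j ≡ true → lookup U i ≡ true × lookup U j ≡ true
    adjacent-in-U i j adj = ∈⇒lookup (pair⊆U (pair-∋ˡ i j)) , ∈⇒lookup (pair⊆U (pair-∋ʳ i j))
      where
      pair⊆U : pair i j ⊆ U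
      pair⊆U = proj₁ (adjacent-inShadow i j adj)

    adjacent-edge : ∀ i j → adjacent i j ≡ true → ∃ λ C → C ∈ edges H × lookup C i ≡ true × lookup C j ≡ true
    adjacent-edge i j adj with find (proj₂ (adjacent-inShadow i j adj))
    ... | C , C∈H , pair⊆C = C , C∈H , ∈⇒lookup (pair⊆C (pair-∋ˡ i j)) , ∈⇒lookup (pair⊆C (pair-∋ʳ i j))

    adjacent-irrefl : ∀ i → adjacent i i ≡ false
    adjacent-irrefl i rewrite ==-refl i = refl

    adjacent-intro : ∀ {e} i j → (i == j) ≡ false → e ∈ E → lookup e i ≡ true → lookup e j ≡ true → adjacent i j ≡ true
    adjacent-intro {e} i j i≠j e∈E i∈e j∈e rewrite i≠j =
      dec-true (inShadow? (pair i j)) ((λ x∈ → lookup⇒∈ (E-⊆U e∈E (∈⇒lookup (pair⊆e x∈)))) , lose (proj₁ (E-edge e∈E)) pair⊆e)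
      where
      pair⊆e : pair i j ⊆ e
      pair⊆e = pair-⊆ i j i∈e j∈e

    adjacent-≤U : ∀ i j → ⟦ adjacent i j ⟧ ≤ ⟦ lookup U j ⟧
    adjacent-≤U i j = ⟦⟧-mono (λ adj → proj₂ (adjacent-in-U i j adj))

    adjacent-≤U′ : ∀ i j → ⟦ adjacent i j ⟧ ≤ ⟦ lookup U i ⟧
    adjacent-≤U′ i j = ⟦⟧-mono (λ adj → proj₁ (adjacent-in-U i j adj))

    m-∑ : m ≡ ∑ (λ i → ⟦ lookup U i ⟧)
    m-∑ = card-∑ U

    deg≤m : ∀ i → deg i ≤ m
    deg≤m i = subst (deg i ≤_) (sym m-∑) (∑-mono (adjacent-≤U i))

    deg-in-U : ∀ i → ⟦ lookup U i ⟧ * deg i ≡ deg i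
    deg-in-U i with lookup U i in i∈U
    ... | true = +-identityʳ (deg i)
    ... | false = sym (n≤0⇒n≡0 (≤-trans (∑-mono (λ j → subst (λ b → ⟦ adjacent i j ⟧ ≤ ⟦ b ⟧) i∈U (adjacent-≤U′ i j)))
                                         (≤-reflexive (∑-zero {n}))))

    -- Cancellativity: two edges {a, b, c} and {a, b, y} (y ∉ {a, b, c}) and an edge C ⊇ {c, y}
    -- would form a member of T₃, since A △ B = {c, y} ⊆ C and A ∪ B ∪ C ⊆ {a, b} ∪ C.
    no-T₃ : ∀ {A B C : Subset n} {a b c y : Fin n} → A ∈ edges H → B ∈ edges H → C ∈ edges H →
      (∀ i → lookup A i ≡ (i == a ∨ i == b ∨ i == c)) → (∀ i → lookup B i ≡ (i == a ∨ i == b ∨ i == y)) →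
      lookup C c ≡ true → lookup C y ≡ true →
      (y == a) ≡ false → (y == b) ≡ false → (y == c) ≡ false → (c == a) ≡ false → (c == b) ≡ false → ⊥
    no-T₃ {A} {B} {C} {a} {b} {c} {y} A∈H B∈H C∈H A≡abc B≡aby c∈C y∈C y≠a y≠b y≠c c≠a c≠b =
      canc A∈H B∈H C∈H (differ y y∉A y∈B) (differ y y∉A y∈C) (differ c c∉B c∈C)
           (≤-trans (union-bound {A = A} {B} {C} {a} {b} {c} {y} A≡abc B≡aby c∈C y∈C) (≤-reflexive (cong (2 +_) (All.lookup (uniform H) C∈H))))
           (difference-⊆ {A = A} {B} {C} {a} {b} {c} {y} A≡abc B≡aby c∈C y∈C)
      where
      y∉A : lookup A y ≡ false
      y∉A rewrite A≡abc y | y≠a | y≠b | y≠c = refl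
      y∈B : lookup B y ≡ true
      y∈B rewrite B≡aby y | y≠a | y≠b | ==-refl y = refl
      c∉B : lookup B c ≡ false
      c∉B rewrite B≡aby c | c≠a | c≠b | ==-sym c y | y≠c = refl
      differ : ∀ {P Q : Subset n} x → lookup P x ≡ false → lookup Q x ≡ true → P ≢ Q
      differ x x∉P x∈Q refl = false≢true (trans (sym x∉P) x∈Q)

    third : Fin n → Fin n → Subset n → Fin n → Bool
    third a b e y = lookup e a ∧ lookup e b ∧ lookup e y ∧ not (y == a) ∧ not (y == b)

    has-third : ∀ {e} → e ∈ E → ∀ a b → ⟦ lookup e a ∧ lookup e b ⟧ ≤ ∑ (λ y → ⟦ third a b e y ⟧)
    has-third {e} e∈E a b with lookup e a | lookup e b
    ... | false | _ = z≤n
    ... | true | false = z≤n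
    ... | true | true = +-cancelˡ-≤ 2 1 _ (begin
        3                                                          ≡⟨ trans (sym (E-card e∈E)) (card-∑ e) ⟩
        ∑ (λ y → ⟦ lookup e y ⟧)                                   ≤⟨ ∑-mono (λ y → split (lookup e y) (y == a) (y == b)) ⟩
        ∑ (λ y → ⟦ y == a ⟧ + ⟦ y == b ⟧ + ⟦ other y ⟧)            ≡⟨ ∑-+ _ (λ y → ⟦ other y ⟧) ⟩
        ∑ (λ y → ⟦ y == a ⟧ + ⟦ y == b ⟧) + ∑ (λ y → ⟦ other y ⟧)  ≡⟨ cong (_+ ∑ (λ y → ⟦ other y ⟧))
                                                                        (trans (∑-+ (λ y → ⟦ y == a ⟧) _) (cong₂ _+_ (∑-point a) (∑-point b))) ⟩
        2 + ∑ (λ y → ⟦ other y ⟧)                                  ∎)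
      where
      open ≤-Reasoning
      other : Fin n → Bool
      other y = lookup e y ∧ not (y == a) ∧ not (y == b)
      split : ∀ l x z → ⟦ l ⟧ ≤ ⟦ x ⟧ + ⟦ z ⟧ + ⟦ l ∧ not x ∧ not z ⟧
      split true true z = s≤s z≤n
      split true false true = s≤s z≤n
      split true false false = s≤s z≤n
      split false x z = z≤n

    third-spans : ∀ e a b y → (a == b) ≡ false → third a b e y ≡ true → Spans e a b y
    third-spans e a b y a≠b t = record
      { x≠y = a≠b ; x≠z = trans (==-sym a y) (not-true y≠a) ; y≠z = trans (==-sym b y) (not-true y≠b)
      ; x∈e = a∈e ; y∈e = b∈e ; z∈e = y∈e }
      where
      a∈e : lookup e a ≡ true
      a∈e = proj₁ (∧-true {lookup e a} t)
      b∈e : lookup e b ≡ true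
      b∈e = proj₁ (∧-true {lookup e b} (proj₂ (∧-true {lookup e a} t)))
      rest : (lookup e y ∧ not (y == a) ∧ not (y == b)) ≡ true
      rest = proj₂ (∧-true {lookup e b} (proj₂ (∧-true {lookup e a} t)))
      y∈e : lookup e y ≡ true
      y∈e = proj₁ (∧-true {lookup e y} rest)
      y≠a : not (y == a) ≡ true
      y≠a = proj₁ (∧-true {not (y == a)} (proj₂ (∧-true {lookup e y} rest)))
      y≠b : not (y == b) ≡ true
      y≠b = proj₂ (∧-true {not (y == a)} (proj₂ (∧-true {lookup e y} rest)))

    third-unique : ∀ a b y → (a == b) ≡ false → count (λ e → third a b e y) E ≤ 1
    third-unique a b y a≠b = count-≤1 _ E E-unique (λ {e₁} {e₂} e₁∈E e₂∈E t₁ t₂ → subset-ext λ i →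
      trans (spans-set (E-card e₁∈E) (third-spans e₁ a b y a≠b t₁) i) (sym (spans-set (E-card e₂∈E) (third-spans e₂ a b y a≠b t₂) i)))

    not-adjacent : ∀ {e e' a b c y} → e ∈ E → e' ∈ E → Spans e a b c → Spans e' a b y → adjacent c y ≡ false
    not-adjacent {e} {e'} {a} {b} {c} {y} e∈E e'∈E s s' with adjacent c y in adj
    ... | false = refl
    ... | true with adjacent-edge c y adj
    ...   | C , C∈H , c∈C , y∈C = ⊥-elim (no-T₃ (proj₁ (E-edge e∈E)) (proj₁ (E-edge e'∈E)) C∈H
              (spans-set (E-card e∈E) s) (spans-set (E-card e'∈E) s') c∈C y∈C
              (trans (==-sym y a) (Spans.x≠z s')) (trans (==-sym y b) (Spans.y≠z s')) y≠c
              (trans (==-sym c a) (Spans.x≠z s)) (trans (==-sym c b) (Spans.y≠z s)))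
      where
      y≠c : (y == c) ≡ false
      y≠c with y == c in y=c
      ... | false = refl
      ... | true = ⊥-elim (false≢true (trans (sym (adjacent-irrefl c)) (subst (λ k → adjacent c k ≡ true) (==-sound {i = y} {c} y=c) adj)))

    third-or-adjacent : ∀ {e a b c} → e ∈ E → Spans e a b c → ∀ y →
      count (λ e' → third a b e' y) E + ⟦ adjacent c y ⟧ ≤ ⟦ lookup U y ⟧
    third-or-adjacent {e} {a} {b} {c} e∈E s y with count-zero-or-witness (λ e' → third a b e' y) E
    ... | inj₁ none rewrite none = adjacent-≤U c y
    ... | inj₂ (e' , e'∈E , t) = subst₂ (λ u v → count (λ e' → third a b e' y) E + ⟦ u ⟧ ≤ ⟦ v ⟧)
      (sym (not-adjacent e∈E e'∈E s s')) (sym (E-⊆U e'∈E (Spans.z∈e s')))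
      (≤-trans (≤-reflexive (+-identityʳ _)) (third-unique a b y (Spans.x≠y s)))
      where
      s' : Spans e' a b y
      s' = third-spans e' a b y (Spans.x≠y s) t

    codeg-bound : ∀ {e a b c} → e ∈ E → Spans e a b c → codeg a b + deg c ≤ m
    codeg-bound {e} {a} {b} {c} e∈E s = begin
      codeg a b + deg c                                        ≤⟨ +-monoˡ-≤ (deg c) (∑ˡ-mono E (λ e'∈E → has-third e'∈E a b)) ⟩
      ∑ˡ (λ e' → ∑ (λ y → ⟦ third a b e' y ⟧)) E + deg c       ≡⟨ cong (_+ deg c) (∑ˡ-∑ (λ e' y → ⟦ third a b e' y ⟧) E) ⟩
      ∑ thirds + deg c                                         ≡⟨ sym (∑-+ thirds (λ y → ⟦ adjacent c y ⟧)) ⟩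
      ∑ (λ y → thirds y + ⟦ adjacent c y ⟧)                    ≤⟨ ∑-mono (third-or-adjacent e∈E s) ⟩
      ∑ (λ y → ⟦ lookup U y ⟧)                                 ≡⟨ sym m-∑ ⟩
      m                                                        ∎
      where
      open ≤-Reasoning
      thirds : Fin n → ℕ
      thirds y = count (λ e' → third a b e' y) E

    -- Common denominator: every codegree and every α is at most N = m + h.
    open ScaledReciprocals (m + h)

    codeg≤N : ∀ i j → codeg i j ≤ m + h
    codeg≤N i j = ≤-trans (count-≤-length (λ e → lookup e i ∧ lookup e j) E) (m≤n+m h m)

    α≤N : ∀ i → α i ≤ m + h
    α≤N i = ≤-trans (m∸n≤m m (deg i)) (m≤m+n m h)

    codeg-pos : ∀ {e} → e ∈ E → ∀ i j → lookup e i ≡ true → lookup e j ≡ true → 1 ≤ codeg i j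
    codeg-pos e∈E i j i∈e j∈e = count-≥1 (λ e → lookup e i ∧ lookup e j) E e∈E (cong₂ _∧_ i∈e j∈e)

    codeg≤α : ∀ {e x y z} → e ∈ E → Spans e x y z → codeg x y ≤ α z
    codeg≤α {x = x} {y} e∈E s = m+n≤o⇒m≤o∸n (codeg x y) (codeg-bound e∈E s)

    α-pos : ∀ {e x y z} → e ∈ E → Spans e x y z → 1 ≤ α z
    α-pos {x = x} {y} e∈E s = ≤-trans (codeg-pos e∈E x y (Spans.x∈e s) (Spans.y∈e s)) (codeg≤α e∈E s)

    weight : Fin n → Fin n → ℕ
    weight i j = if i == j then 0 else recip (codeg i j) * α i

    weight-same : ∀ i j → (i == j) ≡ true → weight i j ≡ 0
    weight-same i j i=j rewrite i=j = refl

    weight-off : ∀ i j → (i == j) ≡ false → weight i j ≡ recip (codeg i j) * α i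
    weight-off i j i≠j rewrite i≠j = refl

    -- In an edge {x, y, z}: weight x y ≥ α(x) / α(z), because codeg x y ≤ α z.
    weight-bound : ∀ {e x y z} → e ∈ E → Spans e x y z → recip (α z) * α x ≤ weight x y
    weight-bound {e} {x} {y} {z} e∈E s = subst (recip (α z) * α x ≤_) (sym (weight-off x y (Spans.x≠y s)))
      (*-monoˡ-≤ (α x) (recip-antitone (codeg x y) (α z) (codeg-pos e∈E x y (Spans.x∈e s) (Spans.y∈e s))
                                       (codeg≤α e∈E s) (α≤N z)))

    -- The two pairs of an edge {x, y, z} ending in y carry weight ≥ α(x)/α(z) + α(z)/α(x) ≥ 2.
    weight-into : ∀ {e x y z} → e ∈ E → Spans e x y z → 2 * K ≤ weight x y + weight z y
    weight-into {e} {x} {y} {z} e∈E s = ≤-trans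
      (recip-am-gm (α x) (α z) (α-pos e∈E (swap₂₃ (swap₁₂ s))) (α-pos e∈E s) (α≤N x) (α≤N z))
      (+-mono-≤ (weight-bound e∈E s) (weight-bound e∈E (swap₁₂ (swap₂₃ (swap₁₂ s)))))

    edgeWeight : Subset n → ℕ
    edgeWeight e = ∑ (λ i → if lookup e i then ∑ (λ j → if lookup e j then weight i j else 0) else 0)

    edgeWeight-elements : ∀ e → edgeWeight e ≡ ∑ˡ (λ i → ∑ˡ (weight i) (elements e)) (elements e)
    edgeWeight-elements e = trans (∑-elements e (λ i → ∑ (λ j → if lookup e j then weight i j else 0)))
                                  (∑ˡ-cong (elements e) (λ i → ∑-elements e (weight i)))

    edgeWeight-pairs : ∀ e → edgeWeight e ≡ ∑ (λ i → ∑ (λ j → ⟦ lookup e i ∧ lookup e j ⟧ * weight i j))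
    edgeWeight-pairs e = ∑-cong (λ i → trans (if-∑ (lookup e i) (λ j → if lookup e j then weight i j else 0))
                                             (∑-cong (λ j → if-if (lookup e i) (lookup e j) (weight i j))))

    -- Every edge in U has total weight at least 6K (2K into each of its vertices).
    edgeWeight-≥ : ∀ {e} → e ∈ E → 6 * K ≤ edgeWeight e
    edgeWeight-≥ {e} e∈E with three-elements e (E-card e∈E)
    ... | a , b , c , listing , a≢b , a≢c , b≢c = begin
      6 * K                                               ≡⟨ three-times K ⟩
      2 * K + 2 * K + 2 * K                               ≤⟨ +-mono-≤ (+-mono-≤ (weight-into e∈E (swap₁₂ s)) (weight-into e∈E s))
                                                                      (weight-into e∈E (swap₂₃ s)) ⟩
      (weight b a + weight c a) + (weight a b + weight c b) + (weight a c + weight b c)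
        ≡⟨ sym (∑ˡ-ordered-pairs weight a b c (weight-same a a (==-refl a)) (weight-same b b (==-refl b)) (weight-same c c (==-refl c))) ⟩
      ∑ˡ (λ i → ∑ˡ (weight i) (a ∷ b ∷ c ∷ [])) (a ∷ b ∷ c ∷ [])
                                                          ≡⟨ cong (λ L → ∑ˡ (λ i → ∑ˡ (weight i) L) L) (sym listing) ⟩
      ∑ˡ (λ i → ∑ˡ (weight i) (elements e)) (elements e)  ≡⟨ sym (edgeWeight-elements e) ⟩
      edgeWeight e                                        ∎
      where
      open ≤-Reasoning
      three-times : ∀ K → 6 * K ≡ 2 * K + 2 * K + 2 * K
      three-times = solve-∀
      listed : ∀ {x} → x ∈ a ∷ b ∷ c ∷ [] → lookup e x ≡ true
      listed x∈ = elements-∈ e (subst (_ ∈_) (sym listing) x∈)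
      s : Spans e a b c
      s = record { x≠y = ==-complete a≢b ; x≠z = ==-complete a≢c ; y≠z = ==-complete b≢c
                 ; x∈e = listed (here refl) ; y∈e = listed (there (here refl)) ; z∈e = listed (there (there (here refl))) }

    -- Summed over all edges, a pair (i, j) receives codeg(i, j) · α(i)/codeg(i, j) = α(i)
    -- (times K) if ij is a shadow edge, and nothing otherwise.
    codeg-weight : ∀ i j → codeg i j * weight i j ≤ ⟦ adjacent i j ⟧ * (K * α i)
    codeg-weight i j with count-zero-or-witness (λ e → lookup e i ∧ lookup e j) E
    ... | inj₁ none = ≤-trans (≤-reflexive (cong (_* weight i j) none)) z≤n
    ... | inj₂ (e , e∈E , ij∈e) = by-cases (i == j) refl
      where
      open ≡-Reasoning
      i∈e : lookup e i ≡ true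
      i∈e = proj₁ (∧-true {lookup e i} ij∈e)
      j∈e : lookup e j ≡ true
      j∈e = proj₂ (∧-true {lookup e i} ij∈e)
      by-cases : ∀ b → (i == j) ≡ b → codeg i j * weight i j ≤ ⟦ adjacent i j ⟧ * (K * α i)
      by-cases true i=j = ≤-trans (≤-reflexive (trans (cong (codeg i j *_) (weight-same i j i=j)) (*-zeroʳ (codeg i j)))) z≤n
      by-cases false i≠j = ≤-reflexive (begin
        codeg i j * weight i j                 ≡⟨ cong (codeg i j *_) (weight-off i j i≠j) ⟩
        codeg i j * (recip (codeg i j) * α i)  ≡⟨ sym (*-assoc (codeg i j) _ (α i)) ⟩
        codeg i j * recip (codeg i j) * α i    ≡⟨ cong (_* α i) (trans (*-comm (codeg i j) _)
                                                     (recip-* (codeg i j) (codeg-pos e∈E i j i∈e j∈e) (codeg≤N i j))) ⟩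
        K * α i                                ≡⟨ sym (+-identityʳ (K * α i)) ⟩
        1 * (K * α i)                          ≡⟨ cong (λ b → ⟦ b ⟧ * (K * α i)) (sym (adjacent-intro i j i≠j e∈E i∈e j∈e)) ⟩
        ⟦ adjacent i j ⟧ * (K * α i)           ∎)

    six-h≤ : 6 * h ≤ ∑ (λ i → deg i * α i)
    six-h≤ = *-cancelˡ-≤ K {{(m + h) !≢0}} (begin
      K * (6 * h)                                        ≡⟨ trans (rearrange K h) (sym (∑ˡ-const (6 * K) E)) ⟩
      ∑ˡ (λ _ → 6 * K) E                                 ≤⟨ ∑ˡ-mono E edgeWeight-≥ ⟩
      ∑ˡ edgeWeight E                                    ≡⟨ ∑ˡ-cong E edgeWeight-pairs ⟩
      ∑ˡ (λ e → ∑ (λ i → ∑ (P e i))) E                   ≡⟨ ∑ˡ-∑ (λ e i → ∑ (P e i)) E ⟩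
      ∑ (λ i → ∑ˡ (λ e → ∑ (P e i)) E)                   ≡⟨ ∑-cong (λ i → ∑ˡ-∑ (λ e j → P e i j) E) ⟩
      ∑ (λ i → ∑ (λ j → ∑ˡ (λ e → P e i j) E))           ≡⟨ ∑-cong (λ i → ∑-cong (λ j → ∑ˡ-*ʳ (λ e → ⟦ lookup e i ∧ lookup e j ⟧) (weight i j) E)) ⟩
      ∑ (λ i → ∑ (λ j → codeg i j * weight i j))         ≤⟨ ∑-mono (λ i → ∑-mono (codeg-weight i)) ⟩
      ∑ (λ i → ∑ (λ j → ⟦ adjacent i j ⟧ * (K * α i)))   ≡⟨ ∑-cong (λ i → ∑-*ʳ (K * α i) (λ j → ⟦ adjacent i j ⟧)) ⟩
      ∑ (λ i → deg i * (K * α i))                        ≡⟨ ∑-cong (λ i → commute (deg i) K (α i)) ⟩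
      ∑ (λ i → K * (deg i * α i))                        ≡⟨ ∑-*ˡ K (λ i → deg i * α i) ⟩
      K * ∑ (λ i → deg i * α i)                          ∎)
      where
      open ≤-Reasoning
      P : Subset n → Fin n → Fin n → ℕ
      P e i j = ⟦ lookup e i ∧ lookup e j ⟧ * weight i j
      rearrange : ∀ K h → K * (6 * h) ≡ 6 * K * h
      rearrange = solve-∀
      commute : ∀ d K a → d * (K * a) ≡ K * (d * a)
      commute = solve-∀

    -- Cauchy–Schwarz applied to the indicator of U and the degrees: (Σ deg)² ≤ m · Σ deg².
    degree-cauchy-schwarz : ∑ deg * ∑ deg ≤ m * ∑ (λ i → deg i * deg i)
    degree-cauchy-schwarz = subst₂ (λ X Y → X * X ≤ Y * ∑ (λ i → deg i * deg i))
      (∑-cong deg-in-U) (trans (∑-cong (λ i → ⟦⟧-square (lookup U i))) (sym m-∑))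
      (cauchy-schwarz (λ i → ⟦ lookup U i ⟧) deg)

    -- Since deg i + α i = m: Σ deg·α + Σ deg² = m · Σ deg.
    ∑-deg-α : ∑ (λ i → deg i * α i) + ∑ (λ i → deg i * deg i) ≡ m * ∑ deg
    ∑-deg-α = trans (sym (∑-+ (λ i → deg i * α i) (λ i → deg i * deg i))) (trans (∑-cong split) (∑-*ˡ m deg))
      where
      split : ∀ i → deg i * α i + deg i * deg i ≡ m * deg i
      split i = trans (sym (*-distribˡ-+ (deg i) (α i) (deg i))) (trans (cong (deg i *_) (m∸n+n≡m (deg≤m i))) (*-comm (deg i) m))

    -- The combinatorial form of the theorem, with g the number of shadow edges in U:
    -- 2·(3mh + 2g²) ≤ m·6h + (Σ deg)² ≤ m·(Σ deg·α + Σ deg²) = m²·Σ deg = 2·g·m².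
    edges-vs-shadow : 3 * m * h + 2 * g * g ≤ g * m * m
    edges-vs-shadow = *-cancelˡ-≤ 2 (begin
      2 * (3 * m * h + 2 * g * g)       ≡⟨ expand m h g ⟩
      m * (6 * h) + (2 * g) * (2 * g)   ≡⟨ cong (λ z → m * (6 * h) + z * z) handshake ⟩
      m * (6 * h) + D * D               ≤⟨ +-monoʳ-≤ (m * (6 * h)) degree-cauchy-schwarz ⟩
      m * (6 * h) + m * Q               ≡⟨ sym (*-distribˡ-+ m (6 * h) Q) ⟩
      m * (6 * h + Q)                   ≤⟨ *-monoʳ-≤ m (+-monoˡ-≤ Q six-h≤) ⟩
      m * (∑ (λ i → deg i * α i) + Q)   ≡⟨ cong (m *_) ∑-deg-α ⟩
      m * (m * D)                       ≡⟨ cong (λ z → m * (m * z)) (sym handshake) ⟩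
      m * (m * (2 * g))                 ≡⟨ collect m g ⟩
      2 * (g * m * m)                   ∎)
      where
      open ≤-Reasoning
      D Q : ℕ
      D = ∑ deg
      Q = ∑ (λ i → deg i * deg i)
      expand : ∀ m h g → 2 * (3 * m * h + 2 * g * g) ≡ m * (6 * h) + (2 * g) * (2 * g)
      expand = solve-∀
      collect : ∀ m g → m * (m * (2 * g)) ≡ 2 * (g * m * m)
      collect = solve-∀

  cancellative-edges-vs-shadow : ∀ {n} (H : ThreeGraph n) → Cancellative H → ∀ (U : Subset n) m → ∣ U ∣ ≡ m →
    3 * m * edgesIn H U + 2 * shadowEdgesIn H U * shadowEdgesIn H U ≤ shadowEdgesIn H U * m * m
  cancellative-edges-vs-shadow H canc U _ refl = ShadowCounting.edges-vs-shadow H canc U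

module RationalBound where

  open import Data.Nat as ℕ using (ℕ; zero; suc)
  open import Data.Integer as ℤ using (+_; +≤+)
  import Data.Integer.Properties as ℤ
  open import Data.Rational using (ℚ; mkℚ; 0ℚ; 1ℚ; ½; _+_; _*_; _-_; _≤_; _/_; -_; Positive; *≤*)
  open import Data.Rational.Properties using (↥p/↧p≡p; ≤-trans; +-monoˡ-≤; +-monoʳ-≤; +-identityʳ; *-zeroʳ; *-cancelˡ-≤-pos)
  open import Data.Rational.Solver using (module +-*-Solver)
  open import Data.Nat.Coprimality using (1-coprimeTo) renaming (sym to coprime-sym)
  open import Data.Empty using (⊥; ⊥-elim)
  open import Relation.Binary.PropositionalEquality
  open import Defs using (ℕ→ℚ)
  open +-*-Solver

  -- ℕ→ℚ a is the fraction a/1 in normal form; hence it is a homomorphism and monotone.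
  ℕ→ℚ-normal : ∀ a → ℕ→ℚ a ≡ mkℚ (+ a) 0 (coprime-sym (1-coprimeTo a))
  ℕ→ℚ-normal a = ↥p/↧p≡p (mkℚ (+ a) 0 (coprime-sym (1-coprimeTo a)))

  ℕ→ℚ-+ : ∀ a b → ℕ→ℚ (a ℕ.+ b) ≡ ℕ→ℚ a + ℕ→ℚ b
  ℕ→ℚ-+ a b = sym (trans (cong₂ _+_ (ℕ→ℚ-normal a) (ℕ→ℚ-normal b))
    (cong (_/ 1) (trans (cong₂ ℤ._+_ (ℤ.*-identityʳ (+ a)) (ℤ.*-identityʳ (+ b))) (sym (ℤ.pos-+ a b)))))

  ℕ→ℚ-* : ∀ a b → ℕ→ℚ (a ℕ.* b) ≡ ℕ→ℚ a * ℕ→ℚ b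
  ℕ→ℚ-* a b = sym (trans (cong₂ _*_ (ℕ→ℚ-normal a) (ℕ→ℚ-normal b)) (cong (_/ 1) (sym (ℤ.pos-* a b))))

  ℕ→ℚ-mono : ∀ {a b} → a ℕ.≤ b → ℕ→ℚ a ≤ ℕ→ℚ b
  ℕ→ℚ-mono {a} {b} a≤b rewrite ℕ→ℚ-normal a | ℕ→ℚ-normal b =
    *≤* (subst₂ ℤ._≤_ (sym (ℤ.*-identityʳ (+ a))) (sym (ℤ.*-identityʳ (+ b))) (+≤+ a≤b))

  ℕ→ℚ-positive : ∀ a .{{_ : ℕ.NonZero a}} → Positive (ℕ→ℚ a)
  ℕ→ℚ-positive (suc k) rewrite ℕ→ℚ-normal (suc k) = _

  -- x·0 ≤ 0 - 1 is impossible, so the hypothesis x·m ≤ m - 1 excludes m = 0.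
  not-below-minus-one : ∀ x → x * ℕ→ℚ 0 ≤ ℕ→ℚ 0 - 1ℚ → ⊥
  not-below-minus-one x le with subst (_≤ ℕ→ℚ 0 - 1ℚ) (*-zeroʳ x) le
  ... | *≤* ()

  defect : ∀ x M → (x * M * M * ½) * M * M - ℕ→ℚ 2 * (x * M * M * ½) * (x * M * M * ½)
                   ≡ ℕ→ℚ 3 * M * ((1ℚ - x) * x * ((+ 1) / 6) * M * M * M)
  defect = solve 2 (λ x M → (x :* M :* M :* con ½ :* M :* M) :- (con (ℕ→ℚ 2) :* (x :* M :* M :* con ½) :* (x :* M :* M :* con ½))
                            := (con (ℕ→ℚ 3) :* M :* ((con 1ℚ :- x) :* x :* con ((+ 1) / 6) :* M :* M :* M))) refl

  density-bound : ∀ (m h g : ℕ) (x : ℚ) → x * ℕ→ℚ m ≤ ℕ→ℚ m - 1ℚ → ℕ→ℚ g ≡ x * ℕ→ℚ m * ℕ→ℚ m * ½ →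
    3 ℕ.* m ℕ.* h ℕ.+ 2 ℕ.* g ℕ.* g ℕ.≤ g ℕ.* m ℕ.* m →
    ℕ→ℚ h ≤ (1ℚ - x) * x * ((+ 1) / 6) * ℕ→ℚ m * ℕ→ℚ m * ℕ→ℚ m + ℕ→ℚ 3 * ℕ→ℚ m * ℕ→ℚ m
  density-bound zero h g x x·m≤m-1 _ _ = ⊥-elim (not-below-minus-one x x·m≤m-1)
  density-bound m@(suc k) h g x _ g≡ combinatorial = ≤-trans h≤R (R≤R+slack)
    where
    M G : ℚ
    M = ℕ→ℚ m
    G = ℕ→ℚ g
    R : ℚ
    R = (1ℚ - x) * x * ((+ 1) / 6) * M * M * M
    cast : ℕ→ℚ 3 * M * ℕ→ℚ h + ℕ→ℚ 2 * G * G ≤ G * M * M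
    cast = subst₂ _≤_
      (trans (ℕ→ℚ-+ (3 ℕ.* m ℕ.* h) (2 ℕ.* g ℕ.* g))
        (cong₂ _+_ (trans (ℕ→ℚ-* (3 ℕ.* m) h) (cong (_* ℕ→ℚ h) (ℕ→ℚ-* 3 m)))
                   (trans (ℕ→ℚ-* (2 ℕ.* g) g) (cong (_* G) (ℕ→ℚ-* 2 g)))))
      (trans (ℕ→ℚ-* (g ℕ.* m) m) (cong (_* M) (ℕ→ℚ-* g m)))
      (ℕ→ℚ-mono combinatorial)
    3mh≤3mR : ℕ→ℚ 3 * M * ℕ→ℚ h ≤ ℕ→ℚ 3 * M * R
    3mh≤3mR = subst₂ _≤_ (cancel (ℕ→ℚ 3 * M * ℕ→ℚ h) (ℕ→ℚ 2 * G * G)) (trans (cong (λ G → G * M * M - ℕ→ℚ 2 * G * G) g≡) (defect x M))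
      (+-monoˡ-≤ (- (ℕ→ℚ 2 * G * G)) cast)
      where
      cancel : ∀ a b → a + b - b ≡ a
      cancel = solve 2 (λ a b → (a :+ b) :- b := a) refl
    h≤R : ℕ→ℚ h ≤ R
    h≤R = *-cancelˡ-≤-pos (ℕ→ℚ 3 * M) {{subst Positive (ℕ→ℚ-* 3 m) (ℕ→ℚ-positive (3 ℕ.* m))}} 3mh≤3mR
    R≤R+slack : R ≤ R + ℕ→ℚ 3 * M * M
    R≤R+slack = subst (_≤ R + ℕ→ℚ 3 * M * M) (+-identityʳ R)
      (+-monoʳ-≤ R (subst (0ℚ ≤_) (trans (ℕ→ℚ-* (3 ℕ.* m) m) (cong (_* M) (ℕ→ℚ-* 3 m))) (ℕ→ℚ-mono {0} {3 ℕ.* m ℕ.* m} ℕ.z≤n)))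

open import Defs
open import Data.Nat using (ℕ)
open import Data.Fin.Subset using (Subset; ∣_∣)
open import Data.Rational using (ℚ; 0ℚ; 1ℚ; ½; _+_; _*_; _-_; _≤_; _/_)
open import Data.Integer using (+_)
open import Relation.Binary.PropositionalEquality using (_≡_)

-- Theorem 4.7.  Only the combinatorial inequality and the shadow density enter.
theorem4p7 : (n : ℕ) (H : ThreeGraph n) → Cancellative H →
    (m : ℕ) (U : Subset n) → ∣ U ∣ ≡ m →
    (x : ℚ) → 0ℚ ≤ x → x * ℕ→ℚ m ≤ ℕ→ℚ m - 1ℚ →
    ℕ→ℚ (shadowEdgesIn H U) ≡ x * ℕ→ℚ m * ℕ→ℚ m * ½ →
    ℕ→ℚ (edgesIn H U) ≤ (1ℚ - x) * x * ((+ 1) / 6) * ℕ→ℚ m * ℕ→ℚ m * ℕ→ℚ m + ℕ→ℚ 3 * ℕ→ℚ m * ℕ→ℚ m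
theorem4p7 n H canc m U |U|≡m x _ x·m≤m-1 shadow≡ =
  RationalBound.density-bound m (edgesIn H U) (shadowEdgesIn H U) x x·m≤m-1 shadow≡
    (Counting.cancellative-edges-vs-shadow H canc U m |U|≡m)
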